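{- Let $k\ge2$, $j\in\{1,\dots,k-1\}$, let $\mathcal{G}$ be a $k$-complex in which each simplex is contained in a $k$-simplex, and let $f$ be an element of $\mathcal{N}_{\mathcal{G}}$ whose support $S$ has smallest size among all elements of $\mathcal{N}_{\mathcal{G}}$. Then $S$ is traversable. In particular, for each $p\in[0,1]$, if $S_p$ exists then it is traversable in $\mathcal{G}_p$.
   Context: Cochains are $\mathbb{F}_2$-valued functions on $i$-simplices (sets of size $i+1$ in the complex); $\delta^i f(\sigma)=\sum_{\tau\subset\sigma,|\tau|=i+1}f(\tau)$ mod 2; a $j$-cocycle is $f$ with $\delta^j f=0$; two $j$-cocycles are in the same cohomology class if they differ by $\delta^{j-1}g$ for some $(j-1)$-cochain $g$. The support of $f$ is the set of $j$-simplices mapped to $1$. For a $k$-simplex $K$ and $C\subseteq K$ with $|C|=j$, $\mathcal{F}(K,C)=\{C\cup\{w\}:w\in K\setminus C\}$. A copy of $M_j^-$ is a pair $(K,C)$ such that each element of $\mathcal{F}(K,C)$ lies in no $k$-simplex other than $K$; the $j$-cochain $f_{K,C}$ with support $\mathcal{F}(K,C)$ is said to arise from it. A $j$-cocycle is generated by copies of $M_j^-$ if it lies in the same cohomology class as a sum of $j$-cocycles arising from copies of $M_j^-$. $\mathcal{N}_{\mathcal{G}}$ denotes the set of $j$-cocycles of $\mathcal{G}$ not generated by copies of $M_j^-$. A set $S$ of $j$-simplices is traversable if the transitive closure of the relation $\sigma_1\sim\sigma_2$ ("$\sigma_1,\sigma_2$ lie in a common $k$-simplex") on $S$ is $S\times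 S$. $\mathcal{G}_p$: random complex on $[n]$ of all singletons and all non-empty subsets of $(k+1)$-sets chosen independently with probability $p$; $S_p$ is the support of an element of $\mathcal{N}_{\mathcal{G}_p}$ with smallest support, if $\mathcal{N}_{\mathcal{G}_p}\ne\emptyset$. -}

module Defs where

open import Data.Bool using (Bool; true; false; _∧_; _∨_; _xor_; not; if_then_else_)
open import Data.Bool.Properties using () renaming (_≟_ to _≟B_)
open import Data.Nat using (ℕ; zero; suc; _≤_; _≡ᵇ_)
open import Data.Fin using (Fin)
open import Data.Fin.Subset using (Subset; _⊆_; ∣_∣; ⁅_⁆; _∪_; inside; outside)
open import Data.Fin.Subset.Properties using (_⊆?_)
open import Data.Vec using (Vec; []; _∷_; lookup; _[_]≔_)
open import Data.Vec.Properties using (≡-dec)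
open import Data.List using (List; []; _∷_; _++_; map; foldr; filter; length; allFin)
open import Data.Bool.ListAction using (any)
open import Data.List.Relation.Unary.All using (All)
open import Data.Product using (Σ; _×_; _,_; ∃; ∃-syntax)
open import Relation.Nullary using (¬_; does)
open import Relation.Binary.PropositionalEquality using (_≡_)
open import Relation.Binary.Construct.Closure.Transitive using (TransClosure)

-- A complex on vertex set Fin n is given by its (decidable) set of simplices.
-- Simplices are subsets of Fin n (Data.Fin.Subset, 'inside' = true).
Complex : ℕ → Set
Complex n = Subset n → Bool

-- Cochains over F₂ (F₂ = Bool with xor as addition). A cochain is a function
-- on subsets; only its values on simplices of the relevant dimension matter.
Cochain : ℕ → Set
Cochain n = Subset n → Bool

allSubsets : (n : ℕ) → List (Subset n)
allSubsets zero = [] ∷ []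
allSubsets (suc n) = map (inside ∷_) (allSubsets n) ++ map (outside ∷_) (allSubsets n)

module _ {n : ℕ} where

  Simplex : Complex n → ℕ → Subset n → Set
  Simplex G i σ = (G σ ≡ true) × (∣ σ ∣ ≡ suc i)

  IsKComplex : ℕ → Complex n → Set
  IsKComplex k G =
    (∀ σ → G σ ≡ true → (1 ≤ ∣ σ ∣) × (∣ σ ∣ ≤ suc k)) ×
    (∀ σ τ → G σ ≡ true → τ ⊆ σ → 1 ≤ ∣ τ ∣ → G τ ≡ true)

  EverySimplexInKSimplex : ℕ → Complex n → Set
  EverySimplexInKSimplex k G = ∀ σ → G σ ≡ true → ∃[ K ] (Simplex G k K × σ ⊆ K)

  -- coboundary: δ f σ = Σ_{x ∈ σ} f (σ ∖ {x})  (mod 2), i.e. the sum of f over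
  -- the subsets of σ with one element fewer.
  δ : Cochain n → Cochain n
  δ f σ = foldr _xor_ false
            (map (λ x → if lookup σ x then f (σ [ x ]≔ outside) else false) (allFin n))

  Cocycle : Complex n → ℕ → Cochain n → Set
  Cocycle G j f = ∀ σ → Simplex G (suc j) σ → δ f σ ≡ false

  Cohomologous : Complex n → ℕ → Cochain n → Cochain n → Set
  Cohomologous G j f f' = ∃[ g ] (∀ σ → Simplex G j σ → (f σ xor f' σ) ≡ δ g σ)

  -- indicator of 𝓕(K,C) = { C ∪ {w} : w ∈ K ∖ C }; this is f_{K,C}
  fKC : Subset n → Subset n → Cochain n
  fKC K C σ = any (λ w → lookup K w ∧ not (lookup C w) ∧ does (≡-dec _≟B_ σ (C ∪ ⁅ w ⁆))) (allFin n)

  IsCopy : Complex n → ℕ → ℕ → Subset n → Subset n → Set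
  IsCopy G k j K C =
    Simplex G k K × C ⊆ K × (∣ C ∣ ≡ j) ×
    (∀ σ → fKC K C σ ≡ true → ∀ K' → Simplex G k K' → σ ⊆ K' → K' ≡ K)

  sumCopies : List (Subset n × Subset n) → Cochain n
  sumCopies L σ = foldr (λ KC b → fKC (Data.Product.proj₁ KC) (Data.Product.proj₂ KC) σ xor b) false L

  GeneratedByCopies : Complex n → ℕ → ℕ → Cochain n → Set
  GeneratedByCopies G k j f =
    ∃[ L ] (All (λ KC → IsCopy G k j (Data.Product.proj₁ KC) (Data.Product.proj₂ KC)
                       × Cocycle G j (fKC (Data.Product.proj₁ KC) (Data.Product.proj₂ KC))) L
            × Cohomologous G j f (sumCopies L))

  InN : Complex n → ℕ → ℕ → Cochain n → Set
  InN G k j f = Cocycle G j f × ¬ GeneratedByCopies G k j f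

  InSupport : Complex n → ℕ → Cochain n → Subset n → Set
  InSupport G j f σ = Simplex G j σ × (f σ ≡ true)

  supportSize : Complex n → ℕ → Cochain n → ℕ
  supportSize G j f =
    length (filter (λ σ → (G σ ∧ (∣ σ ∣ ≡ᵇ suc j) ∧ f σ) Data.Bool.≟ true) (allSubsets n))

  MinimalInN : Complex n → ℕ → ℕ → Cochain n → Set
  MinimalInN G k j f = InN G k j f × (∀ g → InN G k j g → supportSize G j f ≤ supportSize G j g)

  Adj : Complex n → ℕ → (Subset n → Set) → Subset n → Subset n → Set
  Adj G k S a b = S a × S b × ∃[ K ] (Simplex G k K × a ⊆ K × b ⊆ K)

  Traversable : Complex n → ℕ → (Subset n → Set) → Set
  Traversable G k S = ∀ a b → S a → S b → TransClosure (Adj G k S) a b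

  -- realisation of 𝓖_p given the set H of chosen (k+1)-sets:
  -- all singletons and all non-empty subsets of members of H
  Gp : (Subset n → Bool) → Complex n
  Gp H σ = (∣ σ ∣ ≡ᵇ 1) ∨ (not (∣ σ ∣ ≡ᵇ 0) ∧ any (λ K → H K ∧ does (σ ⊆? K)) (allSubsets n))

module Submission where

-- Let f ∈ 𝓝_G have support S of smallest size, let a ∈ S, and let R be the part of S
-- reachable from a through "lie in a common k-simplex".  If some b ∈ S were outside R,
-- write f = f·[R] + f·[not R].  Every (j+1)-simplex lies in a k-simplex, so its support
-- faces are pairwise adjacent and lie all inside or all outside R; hence both summands are
-- cocycles (δ of each is δf or 0).  Both have strictly smaller support (they lose b, resp.
-- a), so by minimality both are generated by copies of M_j^-, and so is their sum f: a
-- contradiction.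

open import Defs
open import Algebra using (CommutativeRing)
open import Data.Bool using (Bool; true; false; _∧_; _∨_; _xor_; not; if_then_else_)
open import Data.Bool.Properties
  using (xor-∧-commutativeRing; xor-assoc; ∧-distribʳ-xor; ∧-zeroʳ; ∨-zeroʳ; T-≡)
  renaming (_≟_ to _≟B_)
open import Data.Bool.ListAction using (any)
open import Data.Empty using (⊥; ⊥-elim)
open import Data.Sum using (_⊎_; inj₁; inj₂)
open import Data.Nat using (ℕ; zero; suc; _≤_; _<_; _+_; _≡ᵇ_; z≤n; s≤s)
open import Data.Nat.Properties
  using (≤-trans; ≤-reflexive; +-suc; +-identityʳ; +-monoˡ-≤; m≤n+m; m≤n⇒m≤1+n;
         ≤-antisym; <⇒≱; ≡ᵇ⇒≡; ≡⇒≡ᵇ; suc-injective)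
  renaming (_≟_ to _≟ℕ_)
open import Data.Fin using (Fin; zero; suc)
import Data.Fin.Properties as Fin
open import Data.Fin.Subset using (Subset; ∣_∣; _⊆_; inside; outside)
open import Data.Fin.Subset.Properties using (_⊆?_; anySubset?; p⊆q⇒∣p∣≤∣q∣; ⊆-refl; ⊆-trans)
open import Data.Vec using ([]; _∷_; lookup; _[_]≔_; here; there)
open import Data.List using (List; []; _∷_; _++_; map; foldr; filter; length; allFin)
open import Data.List.Properties using (map-cong; length-filter)
open import Data.List.Relation.Unary.Any using (any?; satisfied; here; there)
open import Data.List.Relation.Unary.Any.Properties using (any⁺; any⁻)
open import Data.List.Relation.Unary.All.Properties using (++⁺)
open import Data.List.Membership.Propositional using (_∈_; lose)
open import Data.List.Membership.Propositional.Properties using (∈-map⁺; ∈-++⁺ˡ; ∈-++⁺ʳ)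
open import Data.Product using (_×_; _,_; ∃; ∃-syntax; Σ; proj₁; proj₂)
open import Function.Bundles using (Equivalence)
open import Relation.Nullary using (¬_; Dec; yes; no; does; contradiction)
open import Relation.Nullary.Decidable using (_×-dec_; dec-true; dec-false)
open import Relation.Binary.PropositionalEquality
  using (_≡_; refl; sym; trans; cong; cong₂; subst; module ≡-Reasoning)
open import Relation.Binary.Construct.Closure.Transitive using (TransClosure; [_]; _∷_; _∷ʳ_)
open import Algebra.Properties.CommutativeSemigroup
  (CommutativeRing.+-commutativeSemigroup xor-∧-commutativeRing) using (interchange)

∧-split : ∀ {a b} → a ∧ b ≡ true → (a ≡ true) × (b ≡ true)
∧-split {true} {true} _ = refl , refl

∧-intro : ∀ {a b} → a ≡ true → b ≡ true → a ∧ b ≡ true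
∧-intro refl refl = refl

∨-introˡ : ∀ {a} b → a ≡ true → a ∨ b ≡ true
∨-introˡ b refl = refl

∨-introʳ : ∀ a {b} → b ≡ true → a ∨ b ≡ true
∨-introʳ a refl = ∨-zeroʳ a

does-sound : ∀ {P : Set} (P? : Dec P) → does P? ≡ true → P
does-sound (yes p) _ = p

≡ᵇ-sound : ∀ m n → (m ≡ᵇ n) ≡ true → m ≡ n
≡ᵇ-sound m n e = ≡ᵇ⇒≡ m n (Equivalence.from T-≡ e)

any-intro : ∀ {A : Set} (p : A → Bool) {x xs} → x ∈ xs → p x ≡ true → any p xs ≡ true
any-intro p x∈xs px = Equivalence.to T-≡ (any⁺ p (lose x∈xs (Equivalence.from T-≡ px)))

any-witness : ∀ {A : Set} (p : A → Bool) xs → any p xs ≡ true → ∃[ x ] (p x ≡ true)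
any-witness p xs e with x , px ← satisfied (any⁻ p xs (Equivalence.from T-≡ e)) =
  x , Equivalence.to T-≡ px

allSubsets-complete : ∀ {n} (s : Subset n) → s ∈ allSubsets n
allSubsets-complete [] = here refl
allSubsets-complete {suc n} (true ∷ s) = ∈-++⁺ˡ (∈-map⁺ (inside ∷_) (allSubsets-complete s))
allSubsets-complete {suc n} (false ∷ s) =
  ∈-++⁺ʳ (map (inside ∷_) (allSubsets n)) (∈-map⁺ (outside ∷_) (allSubsets-complete s))

count : ∀ {A : Set} → (A → Bool) → List A → ℕ
count P xs = length (filter (λ x → P x ≟B true) xs)

count-mono : ∀ {A : Set} (P Q : A → Bool) → (∀ x → P x ≡ true → Q x ≡ true) →
             ∀ xs → count P xs ≤ count Q xs
count-mono P Q P⇒Q [] = z≤n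
count-mono P Q P⇒Q (x ∷ xs) with P x in eP | Q x in eQ
... | true  | true  = s≤s (count-mono P Q P⇒Q xs)
... | true  | false with () ← trans (sym (P⇒Q x eP)) eQ
... | false | true  = m≤n⇒m≤1+n (count-mono P Q P⇒Q xs)
... | false | false = count-mono P Q P⇒Q xs

count-strict : ∀ {A : Set} (P Q : A → Bool) → (∀ x → P x ≡ true → Q x ≡ true) →
               ∀ xs y → y ∈ xs → P y ≡ false → Q y ≡ true → count P xs < count Q xs
count-strict P Q P⇒Q (x ∷ xs) y (here refl) Py Qy rewrite Py | Qy = s≤s (count-mono P Q P⇒Q xs)
count-strict P Q P⇒Q (x ∷ xs) y (there y∈xs) Py Qy with P x in eP | Q x in eQ
... | true  | true  = s≤s (count-strict P Q P⇒Q xs y y∈xs Py Qy)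
... | true  | false with () ← trans (sym (P⇒Q x eP)) eQ
... | false | true  = m≤n⇒m≤1+n (count-strict P Q P⇒Q xs y y∈xs Py Qy)
... | false | false = count-strict P Q P⇒Q xs y y∈xs Py Qy

-- Starting from the direct successors of a, repeatedly add the successors of the current
-- set; each proper extension increases the count, so after at most |U| rounds the set is
-- closed, and a closed sound set containing the successors of a is exactly the reachable set.

module Reachability {A : Set} (U : List A) (U-complete : ∀ x → x ∈ U)
                    (_~_ : A → A → Set) (_~?_ : ∀ x y → Dec (x ~ y)) (a : A) where

  Sound Seeded Closed : (A → Bool) → Set
  Sound R  = ∀ y → R y ≡ true → TransClosure _~_ a y
  Seeded R = ∀ y → a ~ y → R y ≡ true
  Closed R = ∀ x y → R x ≡ true → x ~ y → R y ≡ true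

  step : (A → Bool) → A → Bool
  step R y = R y ∨ any (λ x → R x ∧ does (x ~? y)) U

  step-sound : ∀ R → Sound R → Sound (step R)
  step-sound R sound y e with R y in Ry
  ... | true = sound y Ry
  ... | false with x , Rx~y ← any-witness _ U e with Rx , x~y ← ∧-split Rx~y =
    sound x Rx ∷ʳ does-sound (x ~? y) x~y

  step-seeded : ∀ R → Seeded R → Seeded (step R)
  step-seeded R seeded y a~y rewrite seeded y a~y = refl

  New : (A → Bool) → A → Set
  New R y = (step R y ≡ true) × (R y ≡ false)

  step-grows : ∀ R y → New R y → count R U < count (step R) U
  step-grows R y (stepy , Ry) =
    count-strict R (step R) (λ x Rx → ∨-introˡ _ Rx) U y (U-complete y) Ry stepy

  no-new-closed : ∀ R → (∀ y → ¬ New R y) → Closed R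
  no-new-closed R none x y Rx x~y with R y in Ry
  ... | true  = refl
  ... | false = ⊥-elim (none y (stepy , Ry))
    where
      stepy : step R y ≡ true
      stepy = ∨-introʳ (R y)
                (any-intro (λ x → R x ∧ does (x ~? y)) (U-complete x) (∧-intro Rx (dec-true (x ~? y) x~y)))

  -- Iterate step with fuel t; the invariant bounds the number of further extensions by t.
  saturate : ∀ t R → Sound R → Seeded R → length U ≤ count R U + t →
             Σ (A → Bool) λ R′ → Sound R′ × Seeded R′ × Closed R′
  saturate t R sound seeded bound with any? (λ y → (step R y ≟B true) ×-dec (R y ≟B false)) U
  ... | no ¬new = R , sound , seeded , no-new-closed R (λ y new → ¬new (lose (U-complete y) new))
  ... | yes new with y , newy ← satisfied new with t
  ...   | zero  = ⊥-elim (<⇒≱ (step-grows R y newy)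
                     (≤-trans (length-filter _ U) (≤-trans bound (≤-reflexive (+-identityʳ _)))))
  ...   | suc t = saturate t (step R) (step-sound R sound) (step-seeded R seeded)
                    (≤-trans bound (≤-trans (≤-reflexive (+-suc _ t)) (+-monoˡ-≤ t (step-grows R y newy))))

  closed-reaches : ∀ R → Closed R → ∀ {x y} → R x ≡ true → TransClosure _~_ x y → R y ≡ true
  closed-reaches R closed Rx [ x~y ] = closed _ _ Rx x~y
  closed-reaches R closed Rx (x~z ∷ z→y) = closed-reaches R closed (closed _ _ Rx x~z) z→y

  reachable-set : Σ (A → Bool) λ R → Sound R × Seeded R × Closed R
  reachable-set = saturate (length U) (λ y → does (a ~? y)) (λ y e → [ does-sound (a ~? y) e ])
                           (λ y a~y → dec-true (a ~? y) a~y) (m≤n+m (length U) _)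

  reaches? : ∀ y → Dec (TransClosure _~_ a y)
  reaches? y with R , sound , seeded , closed ← reachable-set with R y in Ry
  ... | true  = yes (sound y Ry)
  ... | false = no λ a→y → contradiction (trans (sym (reached a→y)) Ry) λ ()
    where
      reached : TransClosure _~_ a y → R y ≡ true
      reached [ a~y ] = seeded y a~y
      reached (a~z ∷ z→y) = closed-reaches R closed (seeded _ a~z) z→y

xorSum : List Bool → Bool
xorSum = foldr _xor_ false

xorSum-xor : ∀ {A : Set} (g h : A → Bool) xs →
  xorSum (map (λ x → g x xor h x) xs) ≡ xorSum (map g xs) xor xorSum (map h xs)
xorSum-xor g h [] = refl
xorSum-xor g h (x ∷ xs) rewrite xorSum-xor g h xs = interchange (g x) (h x) _ _

xorSum-∧ : ∀ {A : Set} (g : A → Bool) b xs → xorSum (map (λ x → g x ∧ b) xs) ≡ xorSum (map g xs) ∧ b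
xorSum-∧ g b [] = refl
xorSum-∧ g b (x ∷ xs) rewrite xorSum-∧ g b xs = sym (∧-distribʳ-xor b (g x) _)

face : ∀ {n} → Subset n → Fin n → Subset n
face σ x = σ [ x ]≔ outside

face-⊆ : ∀ {n} (σ : Subset n) x → face σ x ⊆ σ
face-⊆ (b ∷ σ) zero (there p) = there p
face-⊆ (b ∷ σ) (suc x) here = here
face-⊆ (b ∷ σ) (suc x) (there p) = there (face-⊆ σ x p)

face-size : ∀ {n} (σ : Subset n) x → lookup σ x ≡ true → suc ∣ face σ x ∣ ≡ ∣ σ ∣
face-size (true ∷ σ) zero _ = refl
face-size (true ∷ σ) (suc x) σx = cong suc (face-size σ x σx)
face-size (false ∷ σ) (suc x) σx = face-size σ x σx

module _ {n : ℕ} where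

  faceTerm : Cochain n → Subset n → Fin n → Bool
  faceTerm f σ x = if lookup σ x then f (face σ x) else false

  δ-xor : ∀ (g h : Cochain n) σ → δ (λ τ → g τ xor h τ) σ ≡ δ g σ xor δ h σ
  δ-xor g h σ = trans (cong xorSum (map-cong term-xor (allFin n)))
                      (xorSum-xor (faceTerm g σ) (faceTerm h σ) (allFin n))
    where
      term-xor : ∀ x → faceTerm (λ τ → g τ xor h τ) σ x ≡ faceTerm g σ x xor faceTerm h σ x
      term-xor x with lookup σ x
      ... | true  = refl
      ... | false = refl

  δ-restrict : ∀ (f R : Cochain n) σ b →
    (∀ x → lookup σ x ≡ true → f (face σ x) ≡ true → R (face σ x) ≡ b) →
    δ (λ τ → f τ ∧ R τ) σ ≡ δ f σ ∧ b
  δ-restrict f R σ b R≡b = trans (cong xorSum (map-cong term-∧ (allFin n)))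
                                 (xorSum-∧ (faceTerm f σ) b (allFin n))
    where
      term-∧ : ∀ x → faceTerm (λ τ → f τ ∧ R τ) σ x ≡ faceTerm f σ x ∧ b
      term-∧ x with lookup σ x in σx
      ... | false = refl
      ... | true with f (face σ x) in fx
      ...   | false = refl
      ...   | true  = R≡b x σx fx

  sumCopies-++ : ∀ L₁ L₂ (σ : Subset n) → sumCopies (L₁ ++ L₂) σ ≡ sumCopies L₁ σ xor sumCopies L₂ σ
  sumCopies-++ [] L₂ σ = refl
  sumCopies-++ ((K , C) ∷ L₁) L₂ σ rewrite sumCopies-++ L₁ L₂ σ = sym (xor-assoc (fKC K C σ) _ _)

  generated-sum : ∀ {G k j} (f f₁ f₂ : Cochain n) → (∀ σ → f σ ≡ f₁ σ xor f₂ σ) →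
    GeneratedByCopies G k j f₁ → GeneratedByCopies G k j f₂ → GeneratedByCopies G k j f
  generated-sum {G} {k} {j} f f₁ f₂ f≡ (L₁ , copies₁ , g₁ , coh₁) (L₂ , copies₂ , g₂ , coh₂) =
    L₁ ++ L₂ , ++⁺ copies₁ copies₂ , (λ τ → g₁ τ xor g₂ τ) , coh
    where
      open ≡-Reasoning
      coh : ∀ σ → Simplex G j σ → (f σ xor sumCopies (L₁ ++ L₂) σ) ≡ δ (λ τ → g₁ τ xor g₂ τ) σ
      coh σ sσ = begin
        f σ xor sumCopies (L₁ ++ L₂) σ
          ≡⟨ cong₂ _xor_ (f≡ σ) (sumCopies-++ L₁ L₂ σ) ⟩
        (f₁ σ xor f₂ σ) xor (sumCopies L₁ σ xor sumCopies L₂ σ)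
          ≡⟨ interchange (f₁ σ) (f₂ σ) _ _ ⟩
        (f₁ σ xor sumCopies L₁ σ) xor (f₂ σ xor sumCopies L₂ σ)
          ≡⟨ cong₂ _xor_ (coh₁ σ sσ) (coh₂ σ sσ) ⟩
        δ g₁ σ xor δ g₂ σ
          ≡⟨ sym (δ-xor g₁ g₂ σ) ⟩
        δ (λ τ → g₁ τ xor g₂ τ) σ ∎

module Components {n : ℕ} (k j : ℕ) (1≤j : 1 ≤ j) (G : Complex n)
  (face-closed : ∀ σ τ → G σ ≡ true → τ ⊆ σ → 1 ≤ ∣ τ ∣ → G τ ≡ true)
  (in-k-simplex : ∀ σ → G σ ≡ true → 2 ≤ ∣ σ ∣ → ∃[ K ] (Simplex G k K × σ ⊆ K))
  (f : Cochain n) (f-cocycle : Cocycle G j f) where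

  S : Subset n → Set
  S = InSupport G j f

  _~_ : Subset n → Subset n → Set
  _~_ = Adj G k S

  Closed : (Subset n → Bool) → Set
  Closed R = ∀ σ τ → R σ ≡ true → σ ~ τ → R τ ≡ true

  simplex? : ∀ i σ → Dec (Simplex G i σ)
  simplex? i σ = (G σ ≟B true) ×-dec (∣ σ ∣ ≟ℕ suc i)

  _~?_ : ∀ σ τ → Dec (σ ~ τ)
  σ ~? τ = inS? σ ×-dec inS? τ ×-dec anySubset? (λ K → simplex? k K ×-dec (σ ⊆? K ×-dec τ ⊆? K))
    where
      inS? : ∀ σ → Dec (S σ)
      inS? σ = simplex? j σ ×-dec (f σ ≟B true)

  ~-sym : ∀ {σ τ} → σ ~ τ → τ ~ σ
  ~-sym (sσ , sτ , K , simplexK , σ⊆K , τ⊆K) = sτ , sσ , K , simplexK , τ⊆K , σ⊆K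

  -- Every support simplex lies in some k-simplex (it has j+1 ≥ 2 vertices).
  ~-refl : ∀ {σ} → S σ → σ ~ σ
  ~-refl {σ} sσ@((Gσ , ∣σ∣) , _) with K , simplexK , σ⊆K ← in-k-simplex σ Gσ (subst (2 ≤_) (sym ∣σ∣) (s≤s 1≤j)) =
    sσ , sσ , K , simplexK , σ⊆K , σ⊆K

  closed-constant : ∀ R → Closed R → ∀ {σ τ} → σ ~ τ → R σ ≡ R τ
  closed-constant R closed {σ} {τ} σ~τ with R σ in Rσ | R τ in Rτ
  ... | true  | true  = refl
  ... | false | false = refl
  ... | true  | false = trans (sym (closed σ τ Rσ σ~τ)) Rτ
  ... | false | true  = trans (sym Rσ) (closed τ σ Rτ (~-sym σ~τ))

  complement-closed : ∀ R → Closed R → Closed (λ σ → not (R σ))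
  complement-closed R closed σ τ notRσ σ~τ = trans (cong not (sym (closed-constant R closed σ~τ))) notRσ

  support-face : ∀ σ → Simplex G (suc j) σ → ∀ x → lookup σ x ≡ true → f (face σ x) ≡ true → S (face σ x)
  support-face σ (Gσ , ∣σ∣) x σx fx = (face-closed σ _ Gσ (face-⊆ σ x) (subst (1 ≤_) (sym size) (s≤s z≤n)) , size) , fx
    where
      size : ∣ face σ x ∣ ≡ suc j
      size = suc-injective (trans (face-size σ x σx) ∣σ∣)

  support-faces-adjacent : ∀ σ → Simplex G (suc j) σ → ∀ x y →
    lookup σ x ≡ true → f (face σ x) ≡ true → lookup σ y ≡ true → f (face σ y) ≡ true →
    face σ x ~ face σ y
  support-faces-adjacent σ sσ@(Gσ , ∣σ∣) x y σx fx σy fy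
    with K , simplexK , σ⊆K ← in-k-simplex σ Gσ (subst (2 ≤_) (sym ∣σ∣) (s≤s (s≤s z≤n))) =
    support-face σ sσ x σx fx , support-face σ sσ y σy fy , K , simplexK ,
    ⊆-trans (face-⊆ σ x) σ⊆K , ⊆-trans (face-⊆ σ y) σ⊆K

  restrict : (Subset n → Bool) → Cochain n
  restrict R τ = f τ ∧ R τ

  restrict-cocycle : ∀ R → Closed R → Cocycle G j (restrict R)
  restrict-cocycle R closed σ sσ
    with Fin.any? (λ x → (lookup σ x ≟B true) ×-dec (f (face σ x) ≟B true))
  ... | yes (x₀ , σx₀ , fx₀) = begin
          δ (restrict R) σ               ≡⟨ δ-restrict f R σ (R (face σ x₀)) agrees ⟩
          δ f σ ∧ R (face σ x₀)         ≡⟨ cong (_∧ R (face σ x₀)) (f-cocycle σ sσ) ⟩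
          false                          ∎
    where
      open ≡-Reasoning
      agrees : ∀ x → lookup σ x ≡ true → f (face σ x) ≡ true → R (face σ x) ≡ R (face σ x₀)
      agrees x σx fx = closed-constant R closed (support-faces-adjacent σ sσ x x₀ σx fx σx₀ fx₀)
  ... | no no-support-face =
          trans (δ-restrict f R σ false (λ x σx fx → ⊥-elim (no-support-face (x , σx , fx)))) (∧-zeroʳ _)

  restrict-smaller : ∀ R {σ} → S σ → R σ ≡ false → supportSize G j (restrict R) < supportSize G j f
  restrict-smaller R {σ} ((Gσ , ∣σ∣) , fσ) Rσ =
    count-strict (inSupport (restrict R)) (inSupport f) restricted⇒ (allSubsets n) σ (allSubsets-complete σ)
      lost (∧-intro Gσ (∧-intro (Equivalence.to T-≡ (≡⇒≡ᵇ _ _ ∣σ∣)) fσ))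
    where
      inSupport : Cochain n → Subset n → Bool
      inSupport g τ = G τ ∧ (∣ τ ∣ ≡ᵇ suc j) ∧ g τ

      restricted⇒ : ∀ τ → inSupport (restrict R) τ ≡ true → inSupport f τ ≡ true
      restricted⇒ τ e with Gτ , e′ ← ∧-split {G τ} e with ∣τ∣ , fRτ ← ∧-split {∣ τ ∣ ≡ᵇ suc j} e′ =
        ∧-intro Gτ (∧-intro ∣τ∣ (proj₁ (∧-split fRτ)))

      lost : inSupport (restrict R) σ ≡ false
      lost rewrite Rσ | ∧-zeroʳ (f σ) | ∧-zeroʳ (∣ σ ∣ ≡ᵇ suc j) = ∧-zeroʳ (G σ)

module Minimal {n : ℕ} (k j : ℕ) (1≤j : 1 ≤ j) (G : Complex n)
  (face-closed : ∀ σ τ → G σ ≡ true → τ ⊆ σ → 1 ≤ ∣ τ ∣ → G τ ≡ true)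
  (in-k-simplex : ∀ σ → G σ ≡ true → 2 ≤ ∣ σ ∣ → ∃[ K ] (Simplex G k K × σ ⊆ K))
  (f : Cochain n) (minimal : MinimalInN G k j f) where

  f-cocycle : Cocycle G j f
  f-cocycle = proj₁ (proj₁ minimal)

  open Components k j 1≤j G face-closed in-k-simplex f f-cocycle

  smaller-generated : ∀ g → Cocycle G j g → supportSize G j g < supportSize G j f →
                      ¬ ¬ GeneratedByCopies G k j g
  smaller-generated g g-cocycle smaller not-generated =
    <⇒≱ smaller (proj₂ minimal g (g-cocycle , not-generated))

  ∧-partition : ∀ a r → a ≡ (a ∧ r) xor (a ∧ not r)
  ∧-partition true true = refl
  ∧-partition true false = refl
  ∧-partition false r = refl

  no-proper-closed-part : ∀ R → Closed R → ∀ {a b} → S a → S b → R a ≡ true → R b ≡ false → ⊥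
  no-proper-closed-part R closed sa sb Ra Rb =
    smaller-generated (restrict R) (restrict-cocycle R closed) (restrict-smaller R sb Rb) λ gen₁ →
    smaller-generated (restrict notR) (restrict-cocycle notR (complement-closed R closed))
                      (restrict-smaller notR sa (cong not Ra)) λ gen₂ →
    proj₂ (proj₁ minimal) (generated-sum f (restrict R) (restrict notR) (λ σ → ∧-partition (f σ) (R σ)) gen₁ gen₂)
    where
      notR : Subset n → Bool
      notR σ = not (R σ)

  reaches? : ∀ a b → Dec (TransClosure _~_ a b)
  reaches? a = Reachability.reaches? (allSubsets n) allSubsets-complete _~_ _~?_ a

  -- The set reachable from a is closed and contains a, so it contains every b ∈ S.
  traversable : Traversable G k S
  traversable a b sa sb with reaches? a b
  ... | yes a→b = a→b
  ... | no ¬a→b = ⊥-elim (no-proper-closed-part reachable reachable-closed sa sb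
                            (dec-true (reaches? a a) [ ~-refl sa ]) (dec-false (reaches? a b) ¬a→b))
    where
      reachable : Subset n → Bool
      reachable σ = does (reaches? a σ)

      reachable-closed : Closed reachable
      reachable-closed σ τ σ∈ σ~τ = dec-true (reaches? a τ) (does-sound (reaches? a σ) σ∈ ∷ʳ σ~τ)

module RandomComplex {n : ℕ} (H : Subset n → Bool) where

  Gp-intro : ∀ {σ K} → 1 ≤ ∣ σ ∣ → H K ≡ true → σ ⊆ K → Gp H σ ≡ true
  Gp-intro {σ} {K} 1≤∣σ∣ HK σ⊆K = ∨-introʳ (∣ σ ∣ ≡ᵇ 1) (∧-intro (nonempty 1≤∣σ∣)
    (any-intro (λ K → H K ∧ does (σ ⊆? K)) (allSubsets-complete K) (∧-intro HK (dec-true (σ ⊆? K) σ⊆K))))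
    where
      nonempty : ∀ {m} → 1 ≤ m → not (m ≡ᵇ 0) ≡ true
      nonempty (s≤s _) = refl

  Gp-elim : ∀ σ → Gp H σ ≡ true → (∣ σ ∣ ≡ 1) ⊎ ∃[ K ] ((H K ≡ true) × σ ⊆ K)
  Gp-elim σ e with ∣ σ ∣ ≡ᵇ 1 in singleton
  ... | true  = inj₁ (≡ᵇ-sound _ _ singleton)
  ... | false with K , HK∧σ⊆K ← any-witness _ (allSubsets n) (proj₂ (∧-split {not (∣ σ ∣ ≡ᵇ 0)} e))
                with HK , σ⊆K ← ∧-split HK∧σ⊆K = inj₂ (K , HK , does-sound (σ ⊆? K) σ⊆K)

  Gp-face-closed : ∀ σ τ → Gp H σ ≡ true → τ ⊆ σ → 1 ≤ ∣ τ ∣ → Gp H τ ≡ true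
  Gp-face-closed σ τ Gσ τ⊆σ 1≤∣τ∣ with Gp-elim σ Gσ
  ... | inj₁ ∣σ∣≡1 = ∨-introˡ _ (Equivalence.to T-≡ (≡⇒≡ᵇ _ _ ∣τ∣≡1))
    where
      ∣τ∣≡1 : ∣ τ ∣ ≡ 1
      ∣τ∣≡1 = ≤-antisym (subst (∣ τ ∣ ≤_) ∣σ∣≡1 (p⊆q⇒∣p∣≤∣q∣ τ⊆σ)) 1≤∣τ∣
  ... | inj₂ (K , HK , σ⊆K) = Gp-intro 1≤∣τ∣ HK (⊆-trans τ⊆σ σ⊆K)

  Gp-in-k-simplex : ∀ {k} → (∀ K → H K ≡ true → ∣ K ∣ ≡ suc k) →
    ∀ σ → Gp H σ ≡ true → 2 ≤ ∣ σ ∣ → ∃[ K ] (Simplex (Gp H) k K × σ ⊆ K)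
  Gp-in-k-simplex H-size σ Gσ 2≤∣σ∣ with Gp-elim σ Gσ
  ... | inj₁ ∣σ∣≡1 = ⊥-elim (<⇒≱ (subst (1 <_) ∣σ∣≡1 2≤∣σ∣) (≤-reflexive refl))
  ... | inj₂ (K , HK , σ⊆K) =
    K , (Gp-intro (subst (1 ≤_) (sym (H-size K HK)) (s≤s z≤n)) HK ⊆-refl , H-size K HK) , σ⊆K

lemma5p4 : ∀ (k j : ℕ) → 2 ≤ k → 1 ≤ j → j < k →
    (∀ (n : ℕ) (G : Complex n) → IsKComplex k G → EverySimplexInKSimplex k G →
    ∀ (f : Cochain n) → MinimalInN G k j f → Traversable G k (InSupport G j f))
    ×
    (∀ (n : ℕ) (H : Subset n → Bool) → (∀ K → H K ≡ true → ∣ K ∣ ≡ suc k) →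
    ∀ (f : Cochain n) → MinimalInN (Gp H) k j f → Traversable (Gp H) k (InSupport (Gp H) j f))
lemma5p4 k j _ 1≤j _ = general , random
  where
    general : ∀ n (G : Complex n) → IsKComplex k G → EverySimplexInKSimplex k G →
              ∀ f → MinimalInN G k j f → Traversable G k (InSupport G j f)
    general n G (_ , face-closed) every-in-k f minimal =
      Minimal.traversable k j 1≤j G face-closed (λ σ Gσ _ → every-in-k σ Gσ) f minimal

    random : ∀ n (H : Subset n → Bool) → (∀ K → H K ≡ true → ∣ K ∣ ≡ suc k) →
             ∀ f → MinimalInN (Gp H) k j f → Traversable (Gp H) k (InSupport (Gp H) j f)
    random n H H-size f minimal =
      Minimal.traversable k j 1≤j (Gp H) (RandomComplex.Gp-face-closed H)
                          (RandomComplex.Gp-in-k-simplex H H-size) f minimal
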